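{- A bitopological space $\langle X,\tau^0,\tau^1\rangle$ is a $\mathbf{CL}$-space if and only if the topological space $\langle X,\tau^0\rangle$ is scattered.
   Context: Formulas are in the language with propositional variables, $\top,\bot$, $\neg,\land,\lor,\to$, unary $\Box,\Diamond$ ($\Diamond$ dual of $\Box$) and binary $\rhd$. $\mathbf{CL}$ is the smallest set of formulas containing all propositional tautologies, $\Box(p\to q)\to(\Box p\to\Box q)$, $\Box(\Box p\to p)\to\Box p$, J1: $\Box(p\to q)\to(p\rhd q)$; J2: $(p\rhd q)\land(q\rhd r)\to(p\rhd r)$; J3: $(p\rhd r)\land(q\rhd r)\to((p\lor q)\rhd r)$; J4: $(p\rhd q)\to(\Diamond p\to\Diamond q)$, closed under modus ponens, necessitation and substitution. For a topology $\tau$ on $X$, $d_\tau(Y)=\{x: \text{every } U\in\tau \text{ containing } x \text{ meets } Y\setminus\{x\}\}$, $cd_\tau(Y)=X\setminus d_\tau(X\setminus Y)$. $\langle X,\tau\rangle$ is scattered if every nonempty $Y\subseteq X$ satisfies $Y\setminus d_\tau(Y)\neq\varnothing$. A bitopological space is $\langle X,\tau^0,\tau^1\rangle$ with $X\ne\varnothing$ and $\tau^0,\tau^1$ topologies. $e_{\tau^0,\tau^1}(Y,Z)=\{x:\forall U\in\tau^1[x\in d_{\tau^0}(Y\cap U)\Rightarrow x\in d_{\tau^0}(Z\cap U)]\}$. A valuation $v$ maps formulas to subsets of $X$, Boolean on connectives, with $v(\Box\varphi)=cd_{\tau^0}(v(\varphi))$, $v(\Diamond\varphi)=d_{\tau^0}(v(\varphi))$,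 $v(\varphi\rhd\psi)=e_{\tau^0,\tau^1}(v(\varphi),v(\psi))$. $\mathrm{Log}(X,\tau^0,\tau^1)$ is the set of formulas $\varphi$ with $v(\varphi)=X$ for all valuations $v$. A $\mathbf{CL}$-space is a bitopological space with $\mathbf{CL}\subseteq\mathrm{Log}(X,\tau^0,\tau^1)$. -}

module Defs where

open import Level using (Level)
open import Data.Nat using (ℕ)
open import Data.Bool using (Bool; true; false; not; _∧_; _∨_)
open import Data.Empty using (⊥)
open import Data.Unit using (⊤)
open import Data.Product using (Σ; ∃; _×_; _,_)
open import Data.Sum using (_⊎_)
open import Relation.Nullary using (¬_)
open import Relation.Binary.PropositionalEquality using (_≡_; _≢_)
open import Function.Bundles using (_⇔_)

infixr 4 _⇒_
infixr 5 _∨f_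
infixr 6 _∧f_
infix 7 _▷_

data Formula : Set where
  var  : ℕ → Formula
  ⊤f   : Formula
  ⊥f   : Formula
  ¬f   : Formula → Formula
  _∧f_ : Formula → Formula → Formula
  _∨f_ : Formula → Formula → Formula
  _⇒_  : Formula → Formula → Formula
  □_   : Formula → Formula
  _▷_  : Formula → Formula → Formula

◇_ : Formula → Formula
◇ φ = ¬f (□ (¬f φ))

_[_] : Formula → (ℕ → Formula) → Formula
var n    [ σ ] = σ n
⊤f       [ σ ] = ⊤f
⊥f       [ σ ] = ⊥f
¬f φ     [ σ ] = ¬f (φ [ σ ])
(φ ∧f ψ) [ σ ] = (φ [ σ ]) ∧f (ψ [ σ ])
(φ ∨f ψ) [ σ ] = (φ [ σ ]) ∨f (ψ [ σ ])
(φ ⇒ ψ)  [ σ ] = (φ [ σ ]) ⇒ (ψ [ σ ])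
(□ φ)    [ σ ] = □ (φ [ σ ])
(φ ▷ ψ)  [ σ ] = (φ [ σ ]) ▷ (ψ [ σ ])

-- Propositional tautologies: modality-free formulas true under every
-- Boolean assignment (instances are obtained via the substitution rule).

data Pure : Formula → Set where
  pvar : ∀ n → Pure (var n)
  p⊤  : Pure ⊤f
  p⊥  : Pure ⊥f
  p¬  : ∀ {φ} → Pure φ → Pure (¬f φ)
  p∧  : ∀ {φ ψ} → Pure φ → Pure ψ → Pure (φ ∧f ψ)
  p∨  : ∀ {φ ψ} → Pure φ → Pure ψ → Pure (φ ∨f ψ)
  p⇒  : ∀ {φ ψ} → Pure φ → Pure ψ → Pure (φ ⇒ ψ)

bval : (ℕ → Bool) → Formula → Bool
bval ρ (var n)  = ρ n
bval ρ ⊤f       = true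
bval ρ ⊥f       = false
bval ρ (¬f φ)   = not (bval ρ φ)
bval ρ (φ ∧f ψ) = bval ρ φ ∧ bval ρ ψ
bval ρ (φ ∨f ψ) = bval ρ φ ∨ bval ρ ψ
bval ρ (φ ⇒ ψ)  = not (bval ρ φ) ∨ bval ρ ψ
bval ρ (□ φ)    = false   -- irrelevant: only used on Pure formulas
bval ρ (φ ▷ ψ)  = false   -- irrelevant: only used on Pure formulas

Tautology : Formula → Set
Tautology φ = Pure φ × (∀ (ρ : ℕ → Bool) → bval ρ φ ≡ true)

p q r : Formula
p = var 0
q = var 1
r = var 2

data CL : Formula → Set where
  taut : ∀ {φ} → Tautology φ → CL φ
  axK  : CL (□ (p ⇒ q) ⇒ (□ p ⇒ □ q))
  axL  : CL (□ (□ p ⇒ p) ⇒ □ p)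
  J1   : CL (□ (p ⇒ q) ⇒ (p ▷ q))
  J2   : CL (((p ▷ q) ∧f (q ▷ r)) ⇒ (p ▷ r))
  J3   : CL (((p ▷ r) ∧f (q ▷ r)) ⇒ ((p ∨f q) ▷ r))
  J4   : CL ((p ▷ q) ⇒ (◇ p ⇒ ◇ q))
  mp   : ∀ {φ ψ} → CL (φ ⇒ ψ) → CL φ → CL ψ
  nec  : ∀ {φ} → CL φ → CL (□ φ)
  sub  : ∀ {φ} (σ : ℕ → Formula) → CL φ → CL (φ [ σ ])

Subset : Set → Set₁
Subset X = X → Set

record Topology (X : Set) : Set₁ where
  field
    Idx    : Set
    Open   : Idx → Subset X
    ∅-open : Σ Idx λ i → ∀ x → ¬ Open i x
    X-open : Σ Idx λ i → ∀ x → Open i x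
    ∩-open : ∀ i j → Σ Idx λ k → ∀ x → Open k x ⇔ (Open i x × Open j x)
    ⋃-open : (J : Set) (f : J → Idx) →
             Σ Idx λ k → ∀ x → Open k x ⇔ (Σ J λ j → Open (f j) x)

open Topology public

module _ {X : Set} where

  ∁ : Subset X → Subset X
  ∁ Y x = ¬ Y x

  _∩_ : Subset X → Subset X → Subset X
  (Y ∩ Z) x = Y x × Z x

  d : Topology X → Subset X → Subset X
  d τ Y x = ∀ (i : Idx τ) → Open τ i x → Σ X λ y → Open τ i y × Y y × y ≢ x

  cd : Topology X → Subset X → Subset X
  cd τ Y = ∁ (d τ (∁ Y))

  e : Topology X → Topology X → Subset X → Subset X → Subset X
  e τ₀ τ₁ Y Z x = ∀ (i : Idx τ₁) → d τ₀ (Y ∩ Open τ₁ i) x → d τ₀ (Z ∩ Open τ₁ i) x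

  Scattered : Topology X → Set₁
  Scattered τ = ∀ (Y : Subset X) → (Σ X Y) → Σ X λ x → Y x × ¬ d τ Y x

record BitopSpace : Set₁ where
  field
    X     : Set
    point : X          -- X ≠ ∅
    τ⁰ τ¹ : Topology X

module _ (B : BitopSpace) where
  open BitopSpace B

  ⟦_⟧ : Formula → (ℕ → Subset X) → Subset X
  ⟦ var n ⟧  V x = V n x
  ⟦ ⊤f ⟧     V x = ⊤
  ⟦ ⊥f ⟧     V x = ⊥
  ⟦ ¬f φ ⟧   V x = ¬ ⟦ φ ⟧ V x
  ⟦ φ ∧f ψ ⟧ V x = ⟦ φ ⟧ V x × ⟦ ψ ⟧ V x
  ⟦ φ ∨f ψ ⟧ V x = ⟦ φ ⟧ V x ⊎ ⟦ ψ ⟧ V x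
  ⟦ φ ⇒ ψ ⟧  V x = ⟦ φ ⟧ V x → ⟦ ψ ⟧ V x
  ⟦ □ φ ⟧    V x = cd τ⁰ (⟦ φ ⟧ V) x
  ⟦ φ ▷ ψ ⟧  V x = e τ⁰ τ¹ (⟦ φ ⟧ V) (⟦ ψ ⟧ V) x

  InLog : Formula → Set₁
  InLog φ = ∀ (V : ℕ → Subset X) (x : X) → ⟦ φ ⟧ V x

  CL-space : Set₁
  CL-space = ∀ φ → CL φ → InLog φ

{-# OPTIONS --safe #-}
-- Of the axioms of CL only Löb's axiom constrains the space: everything else
-- holds in every bitopological space because the derived-set operator d is
-- monotone, additive and local, and ▷ is interpreted through d. Löb's axiom
-- holds exactly when every point of d A is a limit of isolated points of A,
-- which is equivalent to τ⁰ having no nonempty dense-in-itself subset, i.e.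
-- to τ⁰ being scattered.
module Submission where

open import Defs
open import Level using (Level)
open import Axiom.ExcludedMiddle using (ExcludedMiddle)
open import Axiom.DoubleNegationElimination using (em⇒dne)
open import Function.Bundles using (_⇔_; mk⇔; Equivalence)
open import Function.Construct.Composition using (_⇔-∘_)
open import Function.Related.TypeIsomorphisms using (→-cong-⇔; ¬-cong-⇔)
open import Data.Nat using (ℕ)
open import Data.Bool using (Bool; true; false; not; _∨_; T)
open import Data.Bool.Properties using (T-≡; T-∧; T-∨)
open import Data.Empty using (⊥-elim)
open import Data.Product using (Σ; _×_; _,_; proj₁; proj₂; map₁)
open import Data.Product.Function.NonDependent.Propositional using (_×-⇔_)
open import Data.Sum using (_⊎_; inj₁; inj₂; [_,_])
open import Data.Sum.Function.Propositional using (_⊎-⇔_)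
open import Relation.Nullary using (¬_; yes; no)
open import Relation.Nullary.Decidable using (isYes; toWitness; fromWitness)
open import Relation.Unary using (_⊆_; _∪_)
open import Relation.Binary.PropositionalEquality using (_≡_; refl)

open Equivalence using (to; from)

T-not : ∀ {b} → T (not b) ⇔ (¬ T b)
T-not {true}  = mk⇔ (λ ()) (λ ¬⊤ → ¬⊤ _)
T-not {false} = mk⇔ (λ _ ()) _

T-⇒ : ∀ {a b} → T (not a ∨ b) ⇔ (T a → T b)
T-⇒ {true}  = mk⇔ (λ Tb _ → Tb) (λ f → f _)
T-⇒ {false} = mk⇔ (λ _ ()) _

module _ {X : Set} (τ : Topology X) where

  d-mono : ∀ {Y Z : Subset X} → Y ⊆ Z → d τ Y ⊆ d τ Z
  d-mono Y⊆Z dY i x∈i with dY i x∈i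
  ... | y , y∈i , Yy , y≢x = y , y∈i , Y⊆Z Yy , y≢x

  d-cong : ∀ {Y Z : Subset X} → (∀ {y} → Y y ⇔ Z y) → ∀ {x} → d τ Y x ⇔ d τ Z x
  d-cong Y⇔Z = mk⇔ (d-mono (to Y⇔Z)) (d-mono (from Y⇔Z))

  d-∅ : ∀ {Y : Subset X} → (∀ y → ¬ Y y) → ∀ x → ¬ d τ Y x
  d-∅ Y-empty x dY with X-open τ
  ... | i , everywhere with dY i (everywhere x)
  ... | y , _ , Yy , _ = Y-empty y Yy

  d-localise : ∀ {A : Subset X} {i x} → Open τ i x → d τ A x → d τ (Open τ i ∩ A) x
  d-localise {i = i} {x} x∈i dA j x∈j with ∩-open τ i j
  ... | k , k⇔i∩j with dA k (from (k⇔i∩j x) (x∈i , x∈j))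
  ... | y , y∈k , Ay , y≢x with to (k⇔i∩j y) y∈k
  ... | y∈i , y∈j = y , y∈j , (y∈i , Ay) , y≢x

  DenseInItself : Subset X → Set
  DenseInItself Y = Y ⊆ d τ Y

  isolated : Subset X → Subset X
  isolated A = A ∩ ∁ (d τ A)

  scattered⇒no-dense-in-itself : Scattered τ → ∀ {Y} → Σ X Y → ¬ DenseInItself Y
  scattered⇒no-dense-in-itself sc {Y} inhabited dense with sc Y inhabited
  ... | x , Yx , ¬dYx = ¬dYx (dense Yx)

module _ {X : Set} (τ₀ τ₁ : Topology X) where

  e-mono : ∀ {Y Y′ Z Z′ : Subset X} → Y′ ⊆ Y → Z ⊆ Z′ → e τ₀ τ₁ Y Z ⊆ e τ₀ τ₁ Y′ Z′
  e-mono Y′⊆Y Z⊆Z′ eYZ i dY′ =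
    d-mono τ₀ (map₁ Z⊆Z′) (eYZ i (d-mono τ₀ (map₁ Y′⊆Y) dY′))

  e-cong : ∀ {Y Y′ Z Z′ : Subset X} → (∀ {y} → Y y ⇔ Y′ y) → (∀ {y} → Z y ⇔ Z′ y) →
           ∀ {x} → e τ₀ τ₁ Y Z x ⇔ e τ₀ τ₁ Y′ Z′ x
  e-cong Y⇔Y′ Z⇔Z′ =
    mk⇔ (e-mono (from Y⇔Y′) (to Z⇔Z′)) (e-mono (to Y⇔Y′) (from Z⇔Z′))

module Semantics (B : BitopSpace) where
  open BitopSpace B

  ⟦_⟧_at_ : Formula → (ℕ → Subset X) → X → Set
  ⟦ φ ⟧ V at x = ⟦_⟧ B φ V x

  ⟦⟧-[] : ∀ φ σ V {x} → ⟦ φ [ σ ] ⟧ V at x ⇔ ⟦ φ ⟧ (λ n → ⟦_⟧ B (σ n) V) at x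
  ⟦⟧-[] (var n)  σ V = mk⇔ (λ h → h) (λ h → h)
  ⟦⟧-[] ⊤f       σ V = mk⇔ (λ h → h) (λ h → h)
  ⟦⟧-[] ⊥f       σ V = mk⇔ (λ h → h) (λ h → h)
  ⟦⟧-[] (¬f φ)   σ V = ¬-cong-⇔ (⟦⟧-[] φ σ V)
  ⟦⟧-[] (φ ∧f ψ) σ V = ⟦⟧-[] φ σ V ×-⇔ ⟦⟧-[] ψ σ V
  ⟦⟧-[] (φ ∨f ψ) σ V = ⟦⟧-[] φ σ V ⊎-⇔ ⟦⟧-[] ψ σ V
  ⟦⟧-[] (φ ⇒ ψ)  σ V = →-cong-⇔ (⟦⟧-[] φ σ V) (⟦⟧-[] ψ σ V)
  ⟦⟧-[] (□ φ)    σ V = ¬-cong-⇔ (d-cong τ⁰ (¬-cong-⇔ (⟦⟧-[] φ σ V)))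
  ⟦⟧-[] (φ ▷ ψ)  σ V = e-cong τ⁰ τ¹ (⟦⟧-[] φ σ V) (⟦⟧-[] ψ σ V)

  ⟦⟧-bval : ∀ {φ} → Pure φ → ∀ {ρ V x} → (∀ n → T (ρ n) ⇔ V n x) →
            T (bval ρ φ) ⇔ ⟦ φ ⟧ V at x
  ⟦⟧-bval (pvar n)  ρ⇔V = ρ⇔V n
  ⟦⟧-bval p⊤        ρ⇔V = mk⇔ (λ h → h) (λ h → h)
  ⟦⟧-bval p⊥        ρ⇔V = mk⇔ (λ h → h) (λ h → h)
  ⟦⟧-bval (p¬ φ)    ρ⇔V = ¬-cong-⇔ (⟦⟧-bval φ ρ⇔V) ⇔-∘ T-not
  ⟦⟧-bval (p∧ φ ψ)  ρ⇔V = (⟦⟧-bval φ ρ⇔V ×-⇔ ⟦⟧-bval ψ ρ⇔V) ⇔-∘ T-∧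
  ⟦⟧-bval (p∨ φ ψ)  ρ⇔V = (⟦⟧-bval φ ρ⇔V ⊎-⇔ ⟦⟧-bval ψ ρ⇔V) ⇔-∘ T-∨
  ⟦⟧-bval (p⇒ φ ψ)  ρ⇔V = →-cong-⇔ (⟦⟧-bval φ ρ⇔V) (⟦⟧-bval ψ ρ⇔V) ⇔-∘ T-⇒

module Classical (lem : ∀ {ℓ : Level} → ExcludedMiddle ℓ) where

  dne : ∀ {P : Set} → ¬ ¬ P → P
  dne = em⇒dne lem

  module _ {X : Set} (τ : Topology X) where

    isolating-neighbourhood : ∀ {Y : Subset X} {x} → ¬ d τ Y x →
      Σ (Idx τ) λ i → Open τ i x × (∀ {y} → Open τ i y → Y y → y ≡ x)
    isolating-neighbourhood ¬dY = dne λ none → ¬dY λ i x∈i →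
      dne λ ¬witness → none (i , x∈i , λ {y} y∈i Yy →
        dne λ y≢x → ¬witness (y , y∈i , Yy , y≢x))

    d-∪ : ∀ {Y Z : Subset X} {x} → d τ (Y ∪ Z) x → d τ Y x ⊎ d τ Z x
    d-∪ {Y} {Z} {x} dYZ with lem {P = d τ Y x} | lem {P = d τ Z x}
    ... | yes dY | _      = inj₁ dY
    ... | no _   | yes dZ = inj₂ dZ
    ... | no ¬dY | no ¬dZ with isolating-neighbourhood ¬dY | isolating-neighbourhood ¬dZ
    ... | i , x∈i , onlyᵢ | j , x∈j , onlyⱼ with ∩-open τ i j
    ... | k , k⇔i∩j with dYZ k (from (k⇔i∩j x) (x∈i , x∈j))
    ... | y , y∈k , inj₁ Yy , y≢x = ⊥-elim (y≢x (onlyᵢ (proj₁ (to (k⇔i∩j y) y∈k)) Yy))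
    ... | y , y∈k , inj₂ Zy , y≢x = ⊥-elim (y≢x (onlyⱼ (proj₂ (to (k⇔i∩j y) y∈k)) Zy))

    d-mono-modulo : ∀ {Y Z W : Subset X} {x} → Y ⊆ Z ∪ W → ¬ d τ W x → d τ Y x → d τ Z x
    d-mono-modulo Y⊆Z∪W ¬dW dY with d-∪ (d-mono τ Y⊆Z∪W dY)
    ... | inj₁ dZ = dZ
    ... | inj₂ dW = ⊥-elim (¬dW dW)

    no-dense-in-itself⇒scattered :
      (∀ {Y} → Σ X Y → ¬ DenseInItself τ Y) → Scattered τ
    no-dense-in-itself⇒scattered no-dense Y inhabited = dne λ no-isolated →
      no-dense inhabited λ {x} Yx → dne λ ¬dY → no-isolated (x , Yx , ¬dY)

    -- Z = {x} ∪ (i ∩ A), where i isolates x from the isolated points of A,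
    -- would otherwise be a nonempty dense-in-itself set.
    scattered⇒d⊆d-isolated : Scattered τ → ∀ {A} → d τ A ⊆ d τ (isolated τ A)
    scattered⇒d⊆d-isolated sc {A} {x} dA = dne λ ¬dIso →
      no-neighbourhood-isolates-x (isolating-neighbourhood ¬dIso)
      where
      no-neighbourhood-isolates-x :
        ¬ (Σ (Idx τ) λ i → Open τ i x × (∀ {y} → Open τ i y → isolated τ A y → y ≡ x))
      no-neighbourhood-isolates-x (i , x∈i , only-x) =
        scattered⇒no-dense-in-itself τ sc (x , inj₁ refl) dense
        where
        Z : Subset X
        Z y = y ≡ x ⊎ (Open τ i y × A y)

        dA-on-i : ∀ {z} → Open τ i z → A z → d τ A z
        dA-on-i {z} z∈i Az with lem {P = d τ A z}
        ... | yes dAz = dAz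
        ... | no ¬dAz with only-x z∈i (Az , ¬dAz)
        ... | refl = dA

        dense : DenseInItself τ Z
        dense (inj₁ refl)       = d-mono τ inj₂ (d-localise τ x∈i dA)
        dense (inj₂ (z∈i , Az)) = d-mono τ inj₂ (d-localise τ z∈i (dA-on-i z∈i Az))

  module _ (B : BitopSpace) where
    open BitopSpace B
    open Semantics B

    tautology-valid : ∀ {φ} → Tautology φ → InLog B φ
    tautology-valid (pure , true-everywhere) V x =
      to (⟦⟧-bval pure {ρ} λ n → mk⇔ toWitness fromWitness) (from T-≡ (true-everywhere ρ))
      where
      ρ : ℕ → Bool
      ρ n = isYes (lem {P = V n x})

    CL-sound : Scattered τ⁰ → ∀ {φ} → CL φ → InLog B φ
    CL-sound sc (taut t) = tautology-valid t
    CL-sound sc axK V x □[p⇒q] □p d¬q =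
      □[p⇒q] (d-mono-modulo τ⁰ split □p d¬q)
      where
        split : ∀ {y} → ¬ V 1 y → ¬ (V 0 y → V 1 y) ⊎ ¬ V 0 y
        split {y} ¬q with lem {P = V 0 y}
        ... | yes p = inj₁ λ p⇒q → ¬q (p⇒q p)
        ... | no ¬p = inj₂ ¬p
    CL-sound sc axL V x □[□p⇒p] d¬p =
      □[□p⇒p] (d-mono τ⁰ (λ (¬p , □p) □p⇒p → ¬p (□p⇒p □p))
                          (scattered⇒d⊆d-isolated τ⁰ sc d¬p))
    CL-sound sc J1 V x □[p⇒q] i dp =
      d-mono-modulo τ⁰ split □[p⇒q] dp
      where
        split : ∀ {y} → V 0 y × Open τ¹ i y → (V 1 y × Open τ¹ i y) ⊎ ¬ (V 0 y → V 1 y)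
        split {y} (p , y∈i) with lem {P = V 1 y}
        ... | yes q = inj₁ (q , y∈i)
        ... | no ¬q = inj₂ λ p⇒q → ¬q (p⇒q p)
    CL-sound sc J2 V x (p▷q , q▷r) i dp = q▷r i (p▷q i dp)
    CL-sound sc J3 V x (p▷r , q▷r) i dp∨q =
      [ p▷r i , q▷r i ] (d-∪ τ⁰ (d-mono τ⁰ distribute dp∨q))
      where
        distribute : ∀ {y} → (V 0 y ⊎ V 1 y) × Open τ¹ i y →
                     (V 0 y × Open τ¹ i y) ⊎ (V 1 y × Open τ¹ i y)
        distribute (inj₁ p , y∈i) = inj₁ (p , y∈i)
        distribute (inj₂ q , y∈i) = inj₂ (q , y∈i)
    CL-sound sc J4 V x p▷q ◇p d¬¬q with X-open τ¹
    ... | i , everywhere = ◇p λ d¬¬p →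
      d¬¬q (d-mono τ⁰ (λ (q , _) ¬q → ¬q q)
             (p▷q i (d-mono τ⁰ (λ {y} ¬¬p → dne ¬¬p , everywhere y) d¬¬p)))
    CL-sound sc (mp ⊢φ⇒ψ ⊢φ) V x = CL-sound sc ⊢φ⇒ψ V x (CL-sound sc ⊢φ V x)
    CL-sound sc (nec ⊢φ) V x = d-∅ τ⁰ (λ y ¬φ → ¬φ (CL-sound sc ⊢φ V y)) x
    CL-sound sc (sub {φ} σ ⊢φ) V x = from (⟦⟧-[] φ σ V) (CL-sound sc ⊢φ _ x)

    -- With p := ∁ Y, the antecedent of Löb's axiom holds everywhere while □p fails on Y.
    Löb-fails-on-dense-in-itself : ∀ {Y} → DenseInItself τ⁰ Y →
      ∀ {x} → Y x → ¬ ⟦ □ (□ p ⇒ p) ⇒ □ p ⟧ (λ _ → ∁ Y) at x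
    Löb-fails-on-dense-in-itself {Y} dense {x} Yx Löb =
      Löb (d-∅ τ⁰ (λ y ¬[□p⇒p] → ¬[□p⇒p] λ □p Yy → □p (d¬¬Y Yy)) x)
          (d¬¬Y Yx)
      where
        d¬¬Y : ∀ {y} → Y y → d τ⁰ (λ z → ¬ ¬ Y z) y
        d¬¬Y Yy = d-mono τ⁰ (λ Yz ¬Yz → ¬Yz Yz) (dense Yy)

    CL-complete : CL-space B → Scattered τ⁰
    CL-complete valid = no-dense-in-itself⇒scattered τ⁰ λ {Y} (x , Yx) dense →
      Löb-fails-on-dense-in-itself dense Yx (valid _ axL (λ _ → ∁ Y) x)

corollary3p5 : (lem : ∀ {ℓ : Level} → ExcludedMiddle ℓ) →
    (B : BitopSpace) →
    CL-space B ⇔ Scattered (BitopSpace.τ⁰ B)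
corollary3p5 lem B =
  mk⇔ (CL-complete B) (λ sc _ ⊢φ → CL-sound B sc ⊢φ)
  where open Classical lem
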